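{- Let $n$ be a positive even integer and $N\ge n$. Then \[ \mathrm{ex}_<(N,P_n^{>,<})=\binom{n-1}{2}+(n-2)(N-n+1). \]
   Context: An ordered graph is a graph whose vertex set is equipped with a total order; an $N$-vertex ordered graph is identified with a graph on $[N]=\{1,\dots,N\}$ ordered as the integers. An ordered graph $G$ contains an ordered graph $H$ if there is an injection $f:V(H)\to V(G)$ such that $f(i)<f(j)$ whenever $i<j$, and $f(i)f(j)\in E(G)$ whenever $ij\in E(H)$; otherwise $G$ avoids $H$. The ordered Turán number $\mathrm{ex}_<(N,H)$ is the maximum number of edges of an ordered graph on $[N]$ avoiding $H$. For $n=2k$ even, $P_n^{>,<}$ is the ordered path on $[n]$ whose vertex sequence $v_1,\dots,v_n$ along the path is given by $v_{2j-1}=k+1-j$ and $v_{2j}=k+j$ for $j=1,\dots,k$. -}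

module Defs where

open import Data.Nat using (ℕ; zero; suc; _+_; _*_; _∸_; _≤_; _<_)
open import Data.Nat.Combinatorics using (_C_)
open import Data.Fin using (Fin; toℕ; fromℕ<; inject₁) renaming (_<_ to _<ᶠ_)
open import Data.Fin as F using ()
open import Data.Bool using (Bool; true; false; if_then_else_)
open import Data.List using (List; []; _∷_; length; filter; allFin; concatMap; map)
open import Data.Product using (Σ; _×_; _,_; ∃-syntax)
open import Relation.Binary.PropositionalEquality using (_≡_)
open import Relation.Nullary using (¬_)
open import Data.Nat.Properties using (_<?_)

-- The edge set is given by a Boolean adjacency; only pairs i < j matter:
-- the edge {i,j} with i < j is present iff adj i j ≡ true.
record OGraph (N : ℕ) : Set where
  field adj : Fin N → Fin N → Bool
open OGraph public

Edge : ∀ {N} → OGraph N → Fin N → Fin N → Set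
Edge G i j = (toℕ i < toℕ j × adj G i j ≡ true) Data.Sum.⊎ (toℕ j < toℕ i × adj G j i ≡ true)
  where import Data.Sum

pairsUp : (N : ℕ) → List (Fin N × Fin N)
pairsUp N = concatMap (λ i → concatMap (λ j → if (Relation.Nullary.Decidable.does (toℕ i <? toℕ j)) then (i , j) ∷ [] else []) (allFin N)) (allFin N)
  where import Relation.Nullary.Decidable

edgeCount : ∀ {N} → OGraph N → ℕ
edgeCount {N} G = length (filter (λ p → Data.Bool._≟_ (adj G (Data.Product.proj₁ p) (Data.Product.proj₂ p)) true) (pairsUp N))
  where import Data.Bool
        import Data.Product

-- G contains H: an order-preserving injection f with edges mapped to edges
-- (order-preserving on a total order = strictly increasing, which implies injective)
Contains : ∀ {N n} → OGraph N → OGraph n → Set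
Contains {N} {n} G H =
  Σ (Fin n → Fin N) λ f →
    (∀ i j → toℕ i < toℕ j → toℕ (f i) < toℕ (f j)) ×
    (∀ i j → Edge H i j → Edge G (f i) (f j))

Avoids : ∀ {N n} → OGraph N → OGraph n → Set
Avoids G H = ¬ Contains G H

IsOrderedTuranNumber : (N : ℕ) → ∀ {n} → OGraph n → ℕ → Set
IsOrderedTuranNumber N H m =
  (Σ (OGraph N) λ G → Avoids G H × edgeCount G ≡ m) ×
  (∀ (G : OGraph N) → Avoids G H → edgeCount G ≤ m)

-- P_{2k}^{>,<}: path vertex sequence v_1..v_{2k}, v_{2j-1}=k+1-j, v_{2j}=k+j (1-indexed).
-- 0-indexed: position p = 2(j-1) ↦ k-j, position p = 2(j-1)+1 ↦ k+j-1.
-- pathVertex k p (p : ℕ, 0-indexed position) gives the 0-indexed vertex.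
pathVertex : ℕ → ℕ → ℕ
pathVertex k p = go p
  where
  half : ℕ → ℕ
  half zero = zero
  half (suc zero) = zero
  half (suc (suc q)) = suc (half q)
  isEven : ℕ → Bool
  isEven zero = true
  isEven (suc zero) = false
  isEven (suc (suc q)) = isEven q
  go : ℕ → ℕ
  go p = if isEven p then k ∸ suc (half p) else k + half p

pathAdj : (k : ℕ) → ℕ → ℕ → Bool
pathAdj k a b = anyPos (2 * k)
  where
  open import Data.Bool using (_∨_; _∧_)
  open import Data.Nat using (_≡ᵇ_)
  consec : ℕ → Bool
  consec p = ((pathVertex k p ≡ᵇ a) ∧ (pathVertex k (suc p) ≡ᵇ b))
           ∨ ((pathVertex k p ≡ᵇ b) ∧ (pathVertex k (suc p) ≡ᵇ a))
  anyPos : ℕ → Bool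
  anyPos zero = false
  anyPos (suc zero) = false
  anyPos (suc (suc m)) = consec m ∨ anyPos (suc m)

P>< : (k : ℕ) → OGraph (2 * k)
P>< k = record { adj = λ i j → pathAdj k (toℕ i) (toℕ j) }

-- A copy of P_{2k}^{>,<} in an ordered graph is a zigzag: k nested pairs u_k < ⋯ < u_1 < w_1 < ⋯ < w_k
-- with edges u_i w_i and u_{i+1} w_i.  Delete from a graph on N vertices the last forward edge at every
-- vertex, and then from what is left the first backward edge at every vertex.  This removes at most
-- (N - 1) + (N - 2) edges and isolates both end vertices.  A zigzag among the remaining edges grows by one
-- outer pair in the original graph: its outer edge u_k w_k was not the first backward edge at w_k, and that
-- earlier edge c w_k was not the last forward edge at c, which gives c < u_k and d > w_k with edges c w_k
-- and c d.  So a P_{2k+2}^{>,<}-free graph on N vertices loses at most 2N - 3 edges and leaves a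
-- P_{2k}^{>,<}-free graph on the N - 2 inner vertices, and induction on k gives the upper bound.  It is
-- attained by all pairs meeting the first k or the last k vertices: an increasing embedding of the path
-- maps its middle edge into the remaining vertices, which span no edge.

module Submission where

open import Defs
open import Data.Bool using (Bool; true; false; T; _∧_; _∨_; not; if_then_else_)
import Data.Bool as Bool
open import Data.Bool.Properties using (T-≡; T-∧; T-∨; ∧-zeroʳ; ∨-zeroʳ)
open import Data.Empty using (⊥-elim)
open import Data.Fin using (Fin; toℕ; fromℕ<; inject₁) renaming (zero to fzero; suc to fsuc)
open import Data.Fin.Properties using (toℕ<n; toℕ-fromℕ<; fromℕ<-toℕ; toℕ-inject₁)
open import Data.List using (List; []; _∷_; _++_; length; filter; allFin; concatMap; map; tabulate)
open import Data.List.Properties using (length-++; filter-++; map-tabulate)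
open import Data.Nat
  using (ℕ; zero; suc; _+_; _*_; _∸_; _≤_; _<_; z≤n; s≤s; z<s; s<s; _<ᵇ_; _≤ᵇ_; _≡ᵇ_)
open import Data.Nat.Combinatorics using (_C_; nC1≡n; nCk+nC[k+1]≡[n+1]C[k+1])
open import Data.Nat.ListAction using (sum)
open import Data.Nat.Properties
open import Data.Nat.Solver using (module +-*-Solver)
open import Data.Product using (Σ; _×_; _,_; ∃-syntax; proj₁; proj₂)
open import Data.Sum using (_⊎_; inj₁; inj₂; [_,_]′)
import Data.Sum as Sum
open import Function using (_∘_; _$_)
open import Function.Bundles using (Equivalence)
open import Level using (0ℓ)
open import Relation.Binary.PropositionalEquality
open import Relation.Nullary using (¬_; yes; no; does)
open import Relation.Nullary.Decidable using (dec-true; dec-false; T?; ⌊_⌋; toWitness; fromWitness)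
open import Relation.Unary using (Pred; Decidable)

open import Algebra.Properties.CommutativeSemigroup +-commutativeSemigroup using (interchange)

∑< : ℕ → (ℕ → ℕ) → ℕ
∑< zero    f = 0
∑< (suc n) f = f 0 + ∑< n (f ∘ suc)

syntax ∑< n (λ i → e) = ∑[ i < n ] e

∑-cong : ∀ n {f g : ℕ → ℕ} → (∀ {i} → i < n → f i ≡ g i) → ∑< n f ≡ ∑< n g
∑-cong zero    _  = refl
∑-cong (suc n) eq = cong₂ _+_ (eq z<s) (∑-cong n (eq ∘ s<s))

∑-mono-≤ : ∀ n {f g : ℕ → ℕ} → (∀ {i} → i < n → f i ≤ g i) → ∑< n f ≤ ∑< n g
∑-mono-≤ zero    _  = z≤n
∑-mono-≤ (suc n) le = +-mono-≤ (le z<s) (∑-mono-≤ n (le ∘ s<s))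

∑-distrib-+ : ∀ n (f g : ℕ → ℕ) → ∑[ i < n ] (f i + g i) ≡ ∑< n f + ∑< n g
∑-distrib-+ zero    f g = refl
∑-distrib-+ (suc n) f g =
  trans (cong (f 0 + g 0 +_) (∑-distrib-+ n (f ∘ suc) (g ∘ suc)))
        (interchange (f 0) (g 0) (∑< n (f ∘ suc)) (∑< n (g ∘ suc)))

∑-init-last : ∀ n (f : ℕ → ℕ) → ∑< (suc n) f ≡ ∑< n f + f n
∑-init-last zero    f = +-comm (f 0) 0
∑-init-last (suc n) f = trans (cong (f 0 +_) (∑-init-last n (f ∘ suc))) (sym (+-assoc (f 0) _ _))

∑-const : ∀ n {f : ℕ → ℕ} {c} → (∀ {i} → i < n → f i ≡ c) → ∑< n f ≡ n * c
∑-const zero    _  = refl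
∑-const (suc n) eq = cong₂ _+_ (eq z<s) (∑-const n (eq ∘ s<s))

∑-zero : ∀ n {f : ℕ → ℕ} → (∀ {i} → i < n → f i ≡ 0) → ∑< n f ≡ 0
∑-zero n eq = trans (∑-const n eq) (*-zeroʳ n)

∑-ones : ∀ n {f : ℕ → ℕ} → (∀ {i} → i < n → f i ≡ 1) → ∑< n f ≡ n
∑-ones n eq = trans (∑-const n eq) (*-identityʳ n)

∑-comm : ∀ m n (f : ℕ → ℕ → ℕ) → ∑[ a < m ] ∑[ b < n ] f a b ≡ ∑[ b < n ] ∑[ a < m ] f a b
∑-comm zero    n f = sym (∑-zero n (λ _ → refl))
∑-comm (suc m) n f = trans (cong (∑< n (f 0) +_) (∑-comm m n (f ∘ suc)))
                           (sym (∑-distrib-+ n (f 0) (λ b → ∑[ a < m ] f (suc a) b)))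

indicator : Bool → ℕ
indicator true  = 1
indicator false = 0

indicator-false : ∀ {x} → ¬ T x → indicator x ≡ 0
indicator-false {false} _  = refl
indicator-false {true}  ¬x = ⊥-elim (¬x _)

∑-indicator-≤1 : ∀ n (p : ℕ → Bool) → (∀ {i j} → i < j → j < n → T (p i) → ¬ T (p j)) →
                 ∑[ i < n ] indicator (p i) ≤ 1
∑-indicator-≤1 zero    p unique = z≤n
∑-indicator-≤1 (suc n) p unique with p 0 in p0
... | false = ∑-indicator-≤1 n (p ∘ suc) (λ i<j j<n → unique (s<s i<j) (s<s j<n))
... | true  = ≤-reflexive (cong suc (∑-zero n λ i<n →
                indicator-false (unique z<s (s<s i<n) (subst T (sym p0) _))))

∑-≤-length : ∀ n {f : ℕ → ℕ} → (∀ {i} → i < n → f i ≤ 1) → ∑< n f ≤ n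
∑-≤-length n le = ≤-trans (∑-mono-≤ n le) (≤-reflexive (∑-ones n (λ _ → refl)))

<ᵇ-false : ∀ {m n} → n ≤ m → (m <ᵇ n) ≡ false
<ᵇ-false {m} {n} n≤m = dec-false (m <? n) (≤⇒≯ n≤m)

-- Only the pairs a < b of an adjacency are ever read.
Adj : Set
Adj = ℕ → ℕ → Bool

isEdge : Adj → ℕ → ℕ → Bool
isEdge E a b = (a <ᵇ b) ∧ E a b

forwardDegree backwardDegree : Adj → ℕ → ℕ → ℕ
forwardDegree  E N a = ∑[ b < N ] indicator (isEdge E a b)
backwardDegree E N b = ∑[ a < N ] indicator (isEdge E a b)

count : Adj → ℕ → ℕ
count E N = ∑[ a < N ] forwardDegree E N a

shift : Adj → Adj
shift E a b = E (suc a) (suc b)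

_∩_ _∖_ : Adj → Adj → Adj
(E ∩ Q) a b = E a b ∧ Q a b
(E ∖ Q) a b = E a b ∧ not (Q a b)

isEdge-≥ : ∀ E {a b} → b ≤ a → isEdge E a b ≡ false
isEdge-≥ E {a} {b} b≤a = cong (_∧ E a b) (<ᵇ-false b≤a)

isEdge-< : ∀ E {a b} → a < b → isEdge E a b ≡ E a b
isEdge-< E {a} {b} a<b = cong (_∧ E a b) (dec-true (a <? b) a<b)

count-suc-first : ∀ E N → count E (suc N) ≡ ∑[ b < N ] indicator (E 0 (suc b)) + count (shift E) N
count-suc-first E N = refl

count-suc-last : ∀ E N → count E (suc N) ≡ count E N + ∑[ a < N ] indicator (E a N)
count-suc-last E N = begin
  ∑[ a < suc N ] ∑[ b < suc N ] cell a b
    ≡⟨ ∑-cong (suc N) (λ {a} _ → ∑-init-last N (cell a)) ⟩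
  ∑[ a < suc N ] (∑[ b < N ] cell a b + cell a N)
    ≡⟨ ∑-distrib-+ (suc N) (λ a → ∑[ b < N ] cell a b) (λ a → cell a N) ⟩
  ∑[ a < suc N ] ∑[ b < N ] cell a b + ∑[ a < suc N ] cell a N
    ≡⟨ cong₂ _+_ (∑-init-last N (λ a → ∑[ b < N ] cell a b)) (∑-init-last N (λ a → cell a N)) ⟩
  (count E N + ∑[ b < N ] cell N b) + (∑[ a < N ] cell a N + cell N N)
    ≡⟨ cong₂ (λ x y → (count E N + x) + (∑[ a < N ] cell a N + y))
             (∑-zero N (λ b<N → cong indicator (isEdge-≥ E (<⇒≤ b<N))))
             (cong indicator (isEdge-≥ E ≤-refl)) ⟩
  (count E N + 0) + (∑[ a < N ] cell a N + 0)
    ≡⟨ cong₂ _+_ (+-identityʳ _)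
                 (trans (+-identityʳ _) (∑-cong N (λ a<N → cong indicator (isEdge-< E a<N)))) ⟩
  count E N + ∑[ a < N ] indicator (E a N) ∎
  where
  open ≡-Reasoning
  cell : ℕ → ℕ → ℕ
  cell a b = indicator (isEdge E a b)

count-partition : ∀ E Q N → count E N ≡ count (E ∩ Q) N + count (E ∖ Q) N
count-partition E Q N = begin
  ∑[ a < N ] ∑[ b < N ] indicator (isEdge E a b)
    ≡⟨ ∑-cong N (λ {a} _ → ∑-cong N (λ {b} _ → split (a <ᵇ b) (E a b) (Q a b))) ⟩
  ∑[ a < N ] ∑[ b < N ] (indicator (isEdge (E ∩ Q) a b) + indicator (isEdge (E ∖ Q) a b))
    ≡⟨ ∑-cong N (λ {a} _ → ∑-distrib-+ N _ _) ⟩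
  ∑[ a < N ] (forwardDegree (E ∩ Q) N a + forwardDegree (E ∖ Q) N a)
    ≡⟨ ∑-distrib-+ N _ _ ⟩
  count (E ∩ Q) N + count (E ∖ Q) N ∎
  where
  open ≡-Reasoning
  split : ∀ x e q → indicator (x ∧ e) ≡ indicator (x ∧ (e ∧ q)) + indicator (x ∧ (e ∧ not q))
  split false e     q     = refl
  split true  false q     = refl
  split true  true  false = refl
  split true  true  true  = refl

count-≤-forward : ∀ E N → (∀ {a} → a < N → forwardDegree E N a ≤ 1) → count E N ≤ N ∸ 1
count-≤-forward E zero    _   = z≤n
count-≤-forward E (suc m) deg = begin
  count E (suc m)
    ≡⟨ ∑-init-last m (forwardDegree E (suc m)) ⟩
  ∑[ a < m ] forwardDegree E (suc m) a + forwardDegree E (suc m) m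
    ≡⟨ cong (∑[ a < m ] forwardDegree E (suc m) a +_) lastRowEmpty ⟩
  ∑[ a < m ] forwardDegree E (suc m) a + 0
    ≡⟨ +-identityʳ _ ⟩
  ∑[ a < m ] forwardDegree E (suc m) a
    ≤⟨ ∑-≤-length m (λ a<m → deg (m<n⇒m<1+n a<m)) ⟩
  m ∎
  where
  open ≤-Reasoning
  lastRowEmpty : forwardDegree E (suc m) m ≡ 0
  lastRowEmpty = ∑-zero (suc m) (λ b<1+m → cong indicator (isEdge-≥ E (≤-pred b<1+m)))

count-≤-backward : ∀ E N → (∀ {b} → b < N → backwardDegree E N b ≤ 1) → count E N ≤ N ∸ 1
count-≤-backward E zero    _   = z≤n
count-≤-backward E (suc m) deg = begin
  count E (suc m)
    ≡⟨ ∑-comm (suc m) (suc m) (λ a b → indicator (isEdge E a b)) ⟩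
  backwardDegree E (suc m) 0 + ∑[ b < m ] backwardDegree E (suc m) (suc b)
    ≡⟨ cong (_+ ∑[ b < m ] backwardDegree E (suc m) (suc b)) (∑-zero (suc m) (λ _ → refl)) ⟩
  ∑[ b < m ] backwardDegree E (suc m) (suc b)
    ≤⟨ ∑-≤-length m (λ b<m → deg (s<s b<m)) ⟩
  m ∎
  where open ≤-Reasoning

-- Trimming

∧-elim : ∀ x {y} → T (x ∧ y) → T x × T y
∧-elim _ = Equivalence.to T-∧

isEdge-∖ : ∀ E Q a b → T (isEdge (E ∖ Q) a b) → T (E a b) × ¬ T (Q a b)
isEdge-∖ E Q a b p with a <ᵇ b | E a b | Q a b
... | true  | true  | false = _ , λ ()
... | false | _     | _     = ⊥-elim p
... | true  | false | _     = ⊥-elim p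
... | true  | true  | true  = ⊥-elim p

hasLaterOut : Adj → ℕ → Adj
hasLaterOut E N a b = ⌊ anyUpTo? (λ c → T? ((b <ᵇ c) ∧ E a c)) N ⌋

hasEarlierIn : Adj → Adj
hasEarlierIn E a b = ⌊ anyUpTo? (λ c → T? (E c b)) a ⌋

trimLast : Adj → ℕ → Adj
trimLast E N = E ∩ hasLaterOut E N

trimFirst : Adj → Adj
trimFirst E = E ∩ hasEarlierIn E

hasLaterOut-intro : ∀ E {N} a {b c} → b < c → c < N → T (E a c) → T (hasLaterOut E N a b)
hasLaterOut-intro E a b<c c<N e = fromWitness (_ , c<N , Equivalence.from T-∧ (<⇒<ᵇ b<c , e))

hasLaterOut-elim : ∀ E {N} a b → T (hasLaterOut E N a b) → ∃[ c ] b < c × c < N × T (E a c)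
hasLaterOut-elim E a b later with toWitness later
... | c , c<N , e = c , <ᵇ⇒< b c (proj₁ (∧-elim (b <ᵇ c) e)) , c<N , proj₂ (∧-elim (b <ᵇ c) e)

hasEarlierIn-intro : ∀ E {a} b {c} → c < a → T (E c b) → T (hasEarlierIn E a b)
hasEarlierIn-intro E b c<a e = fromWitness (_ , c<a , e)

hasEarlierIn-elim : ∀ E a b → T (hasEarlierIn E a b) → ∃[ c ] c < a × T (E c b)
hasEarlierIn-elim E a b earlier = toWitness earlier

forwardDegree-∖hasLaterOut-≤1 : ∀ E N a → forwardDegree (E ∖ hasLaterOut E N) N a ≤ 1
forwardDegree-∖hasLaterOut-≤1 E N a =
  ∑-indicator-≤1 N (isEdge (E ∖ L) a) λ {b} {b′} b<b′ b′<N ab ab′ →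
    proj₂ (isEdge-∖ E L a b ab) (hasLaterOut-intro E a b<b′ b′<N (proj₁ (isEdge-∖ E L a b′ ab′)))
  where
  L : Adj
  L = hasLaterOut E N

backwardDegree-∖hasEarlierIn-≤1 : ∀ E N b → backwardDegree (E ∖ hasEarlierIn E) N b ≤ 1
backwardDegree-∖hasEarlierIn-≤1 E N b =
  ∑-indicator-≤1 N (λ a → isEdge (E ∖ F) a b) λ {a} {a′} a<a′ a′<N ab a′b →
    proj₂ (isEdge-∖ E F a′ b a′b) (hasEarlierIn-intro E b a<a′ (proj₁ (isEdge-∖ E F a b ab)))
  where
  F : Adj
  F = hasEarlierIn E

count-trimLast : ∀ E N → count E N ≤ count (trimLast E N) N + (N ∸ 1)
count-trimLast E N = begin
  count E N
    ≡⟨ count-partition E (hasLaterOut E N) N ⟩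
  count (trimLast E N) N + count (E ∖ hasLaterOut E N) N
    ≤⟨ +-monoʳ-≤ (count (trimLast E N) N) (count-≤-forward _ N λ {a} _ → forwardDegree-∖hasLaterOut-≤1 E N a) ⟩
  count (trimLast E N) N + (N ∸ 1) ∎
  where open ≤-Reasoning

count-trimFirst : ∀ E N → count E N ≤ count (trimFirst E) N + (N ∸ 1)
count-trimFirst E N = begin
  count E N
    ≡⟨ count-partition E (hasEarlierIn E) N ⟩
  count (trimFirst E) N + count (E ∖ hasEarlierIn E) N
    ≤⟨ +-monoʳ-≤ (count (trimFirst E) N) (count-≤-backward _ N λ {b} _ → backwardDegree-∖hasEarlierIn-≤1 E N b) ⟩
  count (trimFirst E) N + (N ∸ 1) ∎
  where open ≤-Reasoning

core : Adj → ℕ → Adj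
core E n = shift (trimFirst (trimLast E (suc (suc n))))

count-≤-core : ∀ E n → count E (suc (suc n)) ≤ count (core E n) n + (suc n + n)
count-≤-core E n = begin
  count E (2 + n)
    ≤⟨ count-trimLast E (2 + n) ⟩
  count E₁ (2 + n) + suc n
    ≡⟨ cong (_+ suc n) (trans (count-suc-last E₁ (suc n)) (cong (count E₁ (suc n) +_) noneIntoLast)) ⟩
  (count E₁ (suc n) + 0) + suc n
    ≡⟨ cong (_+ suc n) (+-identityʳ _) ⟩
  count E₁ (suc n) + suc n
    ≤⟨ +-monoˡ-≤ (suc n) (count-trimFirst E₁ (suc n)) ⟩
  (count E₂ (suc n) + n) + suc n
    ≡⟨ cong (λ x → (x + n) + suc n)
            (trans (count-suc-first E₂ n) (cong (_+ count (core E n) n) noneOutOfFirst)) ⟩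
  (count (core E n) n + n) + suc n
    ≡⟨ +-assoc (count (core E n) n) n (suc n) ⟩
  count (core E n) n + (n + suc n)
    ≡⟨ cong (count (core E n) n +_) (+-comm n (suc n)) ⟩
  count (core E n) n + (suc n + n) ∎
  where
  open ≤-Reasoning
  E₁ E₂ : Adj
  E₁ = trimLast E (2 + n)
  E₂ = trimFirst E₁
  noneIntoLast : ∑[ a < suc n ] indicator (E₁ a (suc n)) ≡ 0
  noneIntoLast = ∑-zero (suc n) λ {a} _ → indicator-false λ e →
    let _ , n+1<c , c<n+2 , _ = hasLaterOut-elim E a (suc n) (proj₂ (∧-elim (E a (suc n)) e))
    in <⇒≱ n+1<c (≤-pred c<n+2)
  noneOutOfFirst : ∑[ b < n ] indicator (E₂ 0 (suc b)) ≡ 0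
  noneOutOfFirst = ∑-zero n λ {b} _ → cong indicator (∧-zeroʳ (E₁ 0 (suc b)))

-- Zigzags and the upper bound

-- k + 1 nested pairs u 0 < ⋯ < u k < w k < ⋯ < w 0, indexed from the outside in;
-- u k, w k, u (k ∸ 1), w (k ∸ 1), …, u 0, w 0 is an ordered copy of P>< (suc k).
record Zigzag (E : Adj) (N k : ℕ) : Set where
  field
    u w      : ℕ → ℕ
    u-step   : ∀ {i} → i < k → u i < u (suc i)
    w-step   : ∀ {i} → i < k → w (suc i) < w i
    centre   : u k < w k
    rung     : ∀ {i} → i ≤ k → T (E (u i) (w i))
    diagonal : ∀ {i} → i < k → T (E (u i) (w (suc i)))
    bounded  : w 0 < N

edge-zigzag : ∀ {E N a b} → a < b → b < N → T (E a b) → Zigzag E N 0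
edge-zigzag {a = a} {b} a<b b<N e = record
  { u = λ _ → a ; w = λ _ → b ; u-step = λ () ; w-step = λ ()
  ; centre = a<b ; rung = λ _ → e ; diagonal = λ () ; bounded = b<N }

core-⊆ : ∀ E n {a b} → T (core E n a b) → T (E (suc a) (suc b))
core-⊆ E n {a} {b} e =
  proj₁ (∧-elim (E (suc a) (suc b)) (proj₁ (∧-elim (trimLast E (2 + n) (suc a) (suc b)) e)))

core-extend : ∀ E n {a b} → T (core E n a b) →
              ∃[ c ] ∃[ d ] c < suc a × suc b < d × d < 2 + n × T (E c (suc b)) × T (E c d)
core-extend E n {a} {b} e
  with hasEarlierIn-elim E₁ (suc a) (suc b) (proj₂ (∧-elim (E₁ (suc a) (suc b)) e))
  where
  E₁ : Adj
  E₁ = trimLast E (2 + n)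
... | c , c<a , cb with ∧-elim (E c (suc b)) cb
... | cb′ , later with hasLaterOut-elim E c (suc b) later
... | d , b<d , d<N , cd = c , d , c<a , b<d , d<N , cb′ , cd

zigzag-lift : ∀ {E n k} → Zigzag (core E n) n k → Zigzag E (suc (suc n)) (suc k)
zigzag-lift {E} {n} {k} z with core-extend E n (Zigzag.rung z z≤n)
... | c , d , c<u₀ , w₀<d , d<N , cw₀ , cd = record
  { u = u′ ; w = w′ ; u-step = u′-step ; w-step = w′-step ; centre = s<s centre
  ; rung = rung′ ; diagonal = diagonal′ ; bounded = d<N }
  where
  open Zigzag z
  u′ w′ : ℕ → ℕ
  u′ zero    = c
  u′ (suc i) = suc (u i)
  w′ zero    = d
  w′ (suc i) = suc (w i)
  u′-step : ∀ {i} → i < suc k → u′ i < u′ (suc i)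
  u′-step {zero}  _         = c<u₀
  u′-step {suc i} (s<s i<k) = s<s (u-step i<k)
  w′-step : ∀ {i} → i < suc k → w′ (suc i) < w′ i
  w′-step {zero}  _         = w₀<d
  w′-step {suc i} (s<s i<k) = s<s (w-step i<k)
  rung′ : ∀ {i} → i ≤ suc k → T (E (u′ i) (w′ i))
  rung′ {zero}  _         = cd
  rung′ {suc i} (s≤s i≤k) = core-⊆ E n (rung i≤k)
  diagonal′ : ∀ {i} → i < suc k → T (E (u′ i) (w′ (suc i)))
  diagonal′ {zero}  _         = cw₀
  diagonal′ {suc i} (s<s i<k) = core-⊆ E n (diagonal i<k)

-- Each step pays for the two trimmings of count-≤-core.
bound : ℕ → ℕ → ℕ
bound zero    _             = 0
bound (suc k) zero          = 0
bound (suc k) (suc zero)    = 0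
bound (suc k) (suc (suc n)) = bound k n + (suc n + n)

count-edgeless : ∀ E N → (∀ {a b} → a < b → b < N → ¬ T (E a b)) → count E N ≡ 0
count-edgeless E N edgeless = ∑-zero N λ {a} _ → ∑-zero N λ {b} b<N → indicator-false λ ab →
  let a<b , e = ∧-elim (a <ᵇ b) ab in edgeless (<ᵇ⇒< a b a<b) b<N e

count-≤-bound : ∀ k N E → ¬ Zigzag E N k → count E N ≤ bound k N
count-≤-bound zero          N             E none =
  ≤-reflexive (count-edgeless E N λ a<b b<N e → none (edge-zigzag a<b b<N e))
count-≤-bound (suc k) zero          E none = z≤n
count-≤-bound (suc k) (suc zero)    E none = z≤n
count-≤-bound (suc k) (suc (suc n)) E none =
  ≤-trans (count-≤-core E n) (+-monoˡ-≤ (suc n + n) (count-≤-bound k n (core E n) (none ∘ zigzag-lift)))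

-- The ordered path P>< (suc k)

-- pathVertex and pathAdj compute through local helpers that are not in scope.  These metas are
-- solved by unification against their unfoldings; the with-abstractions turn the helpers' arguments
-- into variables so that the constraints are patterns.  consecutive repeats the body of the helper
-- that anyPos folds over positions.
mutual
  isEven : ℕ → ℕ → ℕ → Bool
  isEven = _

  half : ℕ → ℕ → ℕ → ℕ
  half = _

  anyPos : ℕ → ℕ → ℕ → ℕ → Bool
  anyPos = _

  pathVertex-suc-suc : ∀ k q → pathVertex k (suc (suc q)) ≡
    (if isEven k (suc (suc q)) q then k ∸ suc (suc (half k (suc (suc q)) q)) else k + suc (half k (suc (suc q)) q))
  pathVertex-suc-suc k q with suc (suc q)
  ... | _ = refl

  pathAdj-anyPos : ∀ k a b → pathAdj k a b ≡ anyPos k a b (2 * k)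
  pathAdj-anyPos k a b with 2 * k
  ... | _ = refl

consecutive : ℕ → ℕ → ℕ → ℕ → Bool
consecutive k a b p = ((pathVertex k p ≡ᵇ a) ∧ (pathVertex k (suc p) ≡ᵇ b))
                    ∨ ((pathVertex k p ≡ᵇ b) ∧ (pathVertex k (suc p) ≡ᵇ a))

isEven-double : ∀ k p j → isEven k p (j + j) ≡ true
isEven-double k p zero    = refl
isEven-double k p (suc j) rewrite +-suc j j = isEven-double k p j

half-double : ∀ k p j → half k p (j + j) ≡ j
half-double k p zero    = refl
half-double k p (suc j) rewrite +-suc j j = cong suc (half-double k p j)

pathVertex-even : ∀ k j → pathVertex k (j + j) ≡ k ∸ suc j
pathVertex-even k zero    = refl
pathVertex-even k (suc j) rewrite +-suc j j | pathVertex-suc-suc k (j + j)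
                                | isEven-double k (suc (suc (j + j))) j | half-double k (suc (suc (j + j))) j = refl

isEven-double-suc : ∀ k p j → isEven k p (suc (j + j)) ≡ false
isEven-double-suc k p zero    = refl
isEven-double-suc k p (suc j) rewrite +-suc j j = isEven-double-suc k p j

half-double-suc : ∀ k p j → half k p (suc (j + j)) ≡ j
half-double-suc k p zero    = refl
half-double-suc k p (suc j) rewrite +-suc j j = cong suc (half-double-suc k p j)

pathVertex-odd : ∀ k j → pathVertex k (suc (j + j)) ≡ k + j
pathVertex-odd k zero    = refl
pathVertex-odd k (suc j) rewrite +-suc j j | pathVertex-suc-suc k (suc (j + j))
                               | isEven-double-suc k (suc (suc (suc (j + j)))) j
                               | half-double-suc k (suc (suc (suc (j + j)))) j = refl

anyPos-elim : ∀ k a b m → T (anyPos k a b m) → ∃[ p ] suc p < m × T (consecutive k a b p)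
anyPos-elim k a b zero          ()
anyPos-elim k a b (suc zero)    ()
anyPos-elim k a b (suc (suc m)) t =
  [ (λ here → m , ≤-refl , here)
  , (λ there → let p , p<m , c = anyPos-elim k a b (suc m) there in p , m<n⇒m<1+n p<m , c)
  ]′ (Equivalence.to (T-∨ {consecutive k a b m}) t)

anyPos-intro : ∀ k a b m {p} → suc p < m → T (consecutive k a b p) → T (anyPos k a b m)
anyPos-intro k a b (suc zero)    (s<s ())
anyPos-intro k a b (suc (suc m)) {p} p<m c = Equivalence.from (T-∨ {consecutive k a b m}) $
  [ (λ p<m′ → inj₂ (anyPos-intro k a b (suc m) p<m′ c))
  , (λ p≡m → inj₁ (subst (T ∘ consecutive k a b) (suc-injective p≡m) c))
  ]′ (m<1+n⇒m<n∨m≡n p<m)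

data Parity : ℕ → Set where
  even : ∀ j → Parity (j + j)
  odd  : ∀ j → Parity (suc (j + j))

parity : ∀ p → Parity p
parity zero          = even 0
parity (suc zero)    = odd 0
parity (suc (suc p)) with parity p
... | even j = subst Parity (cong suc (+-suc j j)) (even (suc j))
... | odd  j = subst Parity (cong (suc ∘ suc) (+-suc j j)) (odd (suc j))

-- Numbering the vertices from 0, P>< (suc k) visits k, k + 1, k ∸ 1, k + 2, …, 0, 2k + 1.
data PathEdge (k : ℕ) : ℕ → ℕ → Set where
  rung-edge     : ∀ {j} → j ≤ k → PathEdge k (k ∸ j) (suc k + j)
  diagonal-edge : ∀ {j} → j < k → PathEdge k (k ∸ suc j) (suc k + j)

SamePair : ℕ → ℕ → ℕ → ℕ → Set
SamePair x y a b = (x ≡ a × y ≡ b) ⊎ (x ≡ b × y ≡ a)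

consecutive-elim : ∀ k a b p → T (consecutive k a b p) → SamePair (pathVertex k p) (pathVertex k (suc p)) a b
consecutive-elim k a b p c = Sum.map ends ends (Equivalence.to T-∨ c)
  where
  ends : ∀ {x y} → T ((pathVertex k p ≡ᵇ x) ∧ (pathVertex k (suc p) ≡ᵇ y)) →
         pathVertex k p ≡ x × pathVertex k (suc p) ≡ y
  ends {x} {y} t with Equivalence.to (T-∧ {pathVertex k p ≡ᵇ x}) t
  ... | t₁ , t₂ = ≡ᵇ⇒≡ _ x t₁ , ≡ᵇ⇒≡ _ y t₂

samePair-sym : ∀ {x y a b} → SamePair x y a b → SamePair y x a b
samePair-sym (inj₁ (p , q)) = inj₂ (q , p)
samePair-sym (inj₂ (p , q)) = inj₁ (q , p)

ordered-samePair : ∀ {x y a b} → a < b → x < y → SamePair x y a b → x ≡ a × y ≡ b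
ordered-samePair a<b x<y (inj₁ eq)            = eq
ordered-samePair a<b x<y (inj₂ (refl , refl)) = ⊥-elim (<-asym a<b x<y)

twice : ∀ n → 2 * n ≡ n + n
twice n = cong (n +_) (+-identityʳ n)

twice-suc : ∀ n → 2 * suc n ≡ suc (suc (n + n))
twice-suc n = trans (twice (suc n)) (cong suc (+-suc n n))

even-position-bound : ∀ {j k} → suc (j + j) < 2 * suc k → j ≤ k
even-position-bound {j} {k} lt =
  ≤-pred (*-cancelˡ-< 2 j (suc k) (subst (_< 2 * suc k) (sym (twice j)) (<-trans (n<1+n (j + j)) lt)))

odd-position-bound : ∀ {j k} → suc (suc (j + j)) < 2 * suc k → j < k
odd-position-bound {j} {k} lt =
  ≤-pred (*-cancelˡ-< 2 (suc j) (suc k) (subst (_< 2 * suc k) (sym (twice-suc j)) lt))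

left<right : ∀ k i j → k ∸ i < suc k + j
left<right k i j = s≤s (≤-trans (m∸n≤m k i) (m≤m+n k j))

pathVertex-even-suc : ∀ k j → pathVertex k (suc (suc (j + j))) ≡ k ∸ suc (suc j)
pathVertex-even-suc k j = trans (cong (pathVertex k ∘ suc) (sym (+-suc j j))) (pathVertex-even k (suc j))

pathAdj-edge : ∀ k {a b} → a < b → T (pathAdj (suc k) a b) → PathEdge k a b
pathAdj-edge k {a} {b} a<b adj
  with anyPos-elim (suc k) a b (2 * suc k) (subst T (pathAdj-anyPos (suc k) a b) adj)
... | p , p<2k+2 , c with parity p | consecutive-elim (suc k) a b p c
... | even j | ends
  with ordered-samePair a<b (left<right k j j)
         (subst₂ (λ x y → SamePair x y a b) (pathVertex-even (suc k) j) (pathVertex-odd (suc k) j) ends)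
...   | refl , refl = rung-edge (even-position-bound p<2k+2)
pathAdj-edge k {a} {b} a<b adj | p , p<2k+2 , c | odd j | ends
  with ordered-samePair a<b (left<right k (suc j) j) (samePair-sym
         (subst₂ (λ x y → SamePair x y a b) (pathVertex-odd (suc k) j) (pathVertex-even-suc (suc k) j) ends))
...   | refl , refl = diagonal-edge (odd-position-bound p<2k+2)

pathAdj-middle : ∀ k → T (pathAdj (suc k) k (suc k))
pathAdj-middle k = subst T (sym (pathAdj-anyPos (suc k) k (suc k)))
  (anyPos-intro (suc k) k (suc k) (2 * suc k) (subst (1 <_) (sym (twice-suc k)) (s<s z<s)) first)
  where
  first : T (consecutive (suc k) k (suc k) 0)
  first = Equivalence.from T-∨ (inj₁ (Equivalence.from T-∧
    (≡⇒≡ᵇ k k refl , ≡⇒≡ᵇ (suc k + 0) (suc k) (+-identityʳ (suc k)))))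

-- Ordered graphs through their adjacency on ℕ

Represents : ∀ {N} → OGraph N → Adj → Set
Represents G R = ∀ i j → adj G i j ≡ R (toℕ i) (toℕ j)

adjℕ : ∀ {N} → OGraph N → Adj
adjℕ {N} G a b with a <? N | b <? N
... | yes a<N | yes b<N = adj G (fromℕ< a<N) (fromℕ< b<N)
... | _       | _       = false

adjℕ-represents : ∀ {N} (G : OGraph N) → Represents G (adjℕ G)
adjℕ-represents {N} G i j with toℕ i <? N | toℕ j <? N
... | yes i<N | yes j<N = sym (cong₂ (adj G) (fromℕ<-toℕ i i<N) (fromℕ<-toℕ j j<N))
... | no i≮N  | _       = ⊥-elim (i≮N (toℕ<n i))
... | yes _   | no j≮N  = ⊥-elim (j≮N (toℕ<n j))

length-filter-concatMap : ∀ {A B : Set} {P : Pred B 0ℓ} (P? : Decidable P) (g : A → List B) xs →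
                          length (filter P? (concatMap g xs)) ≡ sum (map (length ∘ filter P? ∘ g) xs)
length-filter-concatMap P? g []       = refl
length-filter-concatMap P? g (x ∷ xs) = begin
  length (filter P? (g x ++ concatMap g xs))
    ≡⟨ cong length (filter-++ P? (g x) _) ⟩
  length (filter P? (g x) ++ filter P? (concatMap g xs))
    ≡⟨ length-++ (filter P? (g x)) ⟩
  length (filter P? (g x)) + length (filter P? (concatMap g xs))
    ≡⟨ cong (length (filter P? (g x)) +_) (length-filter-concatMap P? g xs) ⟩
  length (filter P? (g x)) + sum (map (length ∘ filter P? ∘ g) xs) ∎
  where open ≡-Reasoning

sum-tabulate : ∀ N {g : Fin N → ℕ} (f : ℕ → ℕ) → (∀ i → g i ≡ f (toℕ i)) →
               sum (tabulate g) ≡ ∑< N f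
sum-tabulate zero    f eq = refl
sum-tabulate (suc N) f eq = cong₂ _+_ (eq fzero) (sum-tabulate N (f ∘ suc) (eq ∘ fsuc))

sum-allFin : ∀ N {g : Fin N → ℕ} (f : ℕ → ℕ) → (∀ i → g i ≡ f (toℕ i)) →
             sum (map g (allFin N)) ≡ ∑< N f
sum-allFin N {g} f eq = trans (cong sum (map-tabulate (λ i → i) g)) (sum-tabulate N f eq)

edgeCount-represents : ∀ {N} {G : OGraph N} {R} → Represents G R → edgeCount G ≡ count R N
edgeCount-represents {N} {G} {R} rep =
  trans (length-filter-concatMap P? row (allFin N))
        (sum-allFin N (forwardDegree R N) λ i →
           trans (length-filter-concatMap P? (cell i) (allFin N)) (sum-allFin N _ (cell-count i)))
  where
  P? : Decidable (λ (p : Fin N × Fin N) → adj G (proj₁ p) (proj₂ p) ≡ true)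
  P? (i , j) = adj G i j Bool.≟ true
  cell : Fin N → Fin N → List (Fin N × Fin N)
  cell i j = if does (toℕ i <? toℕ j) then (i , j) ∷ [] else []
  row : Fin N → List (Fin N × Fin N)
  row i = concatMap (cell i) (allFin N)
  cell-count : ∀ i j → length (filter P? (cell i j)) ≡ indicator (isEdge R (toℕ i) (toℕ j))
  cell-count i j with toℕ i <ᵇ toℕ j
  ... | false = refl
  ... | true rewrite rep i j with R (toℕ i) (toℕ j)
  ...   | true  = refl
  ...   | false = refl

Increasing : ∀ {n N} → (Fin n → Fin N) → Set
Increasing f = ∀ i j → toℕ i < toℕ j → toℕ (f i) < toℕ (f j)

increasing-≥ : ∀ {n N} (f : Fin n → Fin N) → Increasing f → ∀ i → toℕ i ≤ toℕ (f i)
increasing-≥         f inc fzero    = z≤n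
increasing-≥ {suc n} f inc (fsuc i) = begin-strict
  toℕ i                    ≤⟨ increasing-≥ (f ∘ inject₁) inc′ i ⟩
  toℕ (f (inject₁ i))      <⟨ inc (inject₁ i) (fsuc i) (s≤s (≤-reflexive (toℕ-inject₁ i))) ⟩
  toℕ (f (fsuc i))         ∎
  where
  open ≤-Reasoning
  inc′ : Increasing (f ∘ inject₁)
  inc′ i j = inc (inject₁ i) (inject₁ j) ∘ subst₂ _<_ (sym (toℕ-inject₁ i)) (sym (toℕ-inject₁ j))

increasing-suc : ∀ {n N} (f : Fin (suc n) → Fin N) → Increasing f → Increasing (f ∘ fsuc)
increasing-suc f inc i j = inc (fsuc i) (fsuc j) ∘ s<s

increasing-room : ∀ {n N} (f : Fin n → Fin N) → Increasing f → ∀ i → toℕ (f i) + (n ∸ toℕ i) ≤ N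
increasing-room {suc zero}    f inc fzero    =
  ≤-trans (≤-reflexive (+-comm (toℕ (f fzero)) 1)) (toℕ<n (f fzero))
increasing-room {suc (suc n)} {N} f inc fzero = begin
  toℕ (f fzero) + suc (suc n)    ≡⟨ +-suc (toℕ (f fzero)) (suc n) ⟩
  suc (toℕ (f fzero)) + suc n    ≤⟨ +-monoˡ-≤ (suc n) (inc fzero (fsuc fzero) z<s) ⟩
  toℕ (f (fsuc fzero)) + suc n   ≤⟨ increasing-room (f ∘ fsuc) (increasing-suc f inc) fzero ⟩
  N                              ∎
  where open ≤-Reasoning
increasing-room {suc n}       f inc (fsuc i) = increasing-room (f ∘ fsuc) (increasing-suc f inc) i

contains-of-increasing : ∀ {n N} {G : OGraph N} {H : OGraph n} {R S : Adj} → Represents G R → Represents H S →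
  (f : ℕ → ℕ) → (∀ {x} → x < n → f x < N) → (∀ {x y} → x < y → y < n → f x < f y) →
  (∀ {x y} → x < y → y < n → T (S x y) → T (R (f x) (f y))) → Contains G H
contains-of-increasing {n} {N} {G} {H} {R} {S} repG repH f bounded increasing preserves =
  F , F-increasing , edges
  where
  F : Fin n → Fin N
  F i = fromℕ< (bounded (toℕ<n i))
  toℕ-F : ∀ i → toℕ (F i) ≡ f (toℕ i)
  toℕ-F i = toℕ-fromℕ< (bounded (toℕ<n i))
  F-increasing : Increasing F
  F-increasing i j lt = subst₂ _<_ (sym (toℕ-F i)) (sym (toℕ-F j)) (increasing lt (toℕ<n j))
  adj-F : ∀ i j → toℕ i < toℕ j → adj H i j ≡ true → adj G (F i) (F j) ≡ true
  adj-F i j lt e = begin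
    adj G (F i) (F j)                  ≡⟨ repG (F i) (F j) ⟩
    R (toℕ (F i)) (toℕ (F j))          ≡⟨ cong₂ R (toℕ-F i) (toℕ-F j) ⟩
    R (f (toℕ i)) (f (toℕ j))
      ≡⟨ Equivalence.to T-≡ (preserves lt (toℕ<n j) (Equivalence.from T-≡ (trans (sym (repH i j)) e))) ⟩
    true                               ∎
    where open ≡-Reasoning
  edges : ∀ i j → Edge H i j → Edge G (F i) (F j)
  edges i j (inj₁ (i<j , e)) = inj₁ (F-increasing i j i<j , adj-F i j i<j e)
  edges i j (inj₂ (j<i , e)) = inj₂ (F-increasing j i j<i , adj-F j i j<i e)

increasing-of-step : ∀ {n} (f : ℕ → ℕ) → (∀ {x} → suc x < n → f x < f (suc x)) →
                     ∀ {x y} → x < y → y < n → f x < f y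
increasing-of-step f step {x} {suc y} x<1+y 1+y<n with m<1+n⇒m<n∨m≡n x<1+y
... | inj₁ x<y  = <-trans (increasing-of-step f step x<y (<-trans (n<1+n y) 1+y<n)) (step 1+y<n)
... | inj₂ refl = step 1+y<n

data Side (k : ℕ) : ℕ → Set where
  left  : ∀ {x} → x ≤ k → Side k x
  right : ∀ y → Side k (suc k + y)

side : ∀ k x → Side k x
side k x with x ≤? k
... | yes x≤k = left x≤k
... | no  x≰k = subst (Side k) (m+[n∸m]≡n (≰⇒> x≰k)) (right (x ∸ suc k))

module ZigzagEmbedding {E N k} (z : Zigzag E N k) where
  open Zigzag z

  vertex : ℕ → ℕ
  vertex x = if x ≤ᵇ k then u x else w (k ∸ (x ∸ suc k))

  vertex-left : ∀ {x} → x ≤ k → vertex x ≡ u x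
  vertex-left {x} x≤k = cong (if_then u x else w (k ∸ (x ∸ suc k))) (dec-true (x ≤? k) x≤k)

  vertex-right : ∀ y → vertex (suc k + y) ≡ w (k ∸ y)
  vertex-right y = cong₂ (if_then u (suc k + y) else_)
    (dec-false (suc k + y ≤? k) (<⇒≱ (s≤s (m≤m+n k y)))) (cong (w ∘ (k ∸_)) (m+n∸m≡n (suc k) y))

  vertex-centre : vertex (suc k) ≡ w k
  vertex-centre = trans (cong vertex (sym (+-identityʳ (suc k)))) (vertex-right 0)

  vertex-last : vertex (suc k + k) ≡ w 0
  vertex-last = trans (vertex-right k) (cong w (n∸n≡0 k))

  vertex-step : ∀ {x} → suc x < 2 * suc k → vertex x < vertex (suc x)
  vertex-step {x} x+1<2k+2 with side k x
  ... | left x≤k with m≤n⇒m<n∨m≡n x≤k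
  ...   | inj₁ x<k  = subst₂ _<_ (sym (vertex-left x≤k)) (sym (vertex-left x<k)) (u-step x<k)
  ...   | inj₂ refl = subst₂ _<_ (sym (vertex-left x≤k)) (sym vertex-centre) centre
  vertex-step x+1<2k+2 | right y =
    subst₂ _<_ (sym (vertex-right y)) (sym (trans (cong vertex (sym (+-suc (suc k) y))) (vertex-right (suc y))))
      (subst (λ i → w i < w (k ∸ suc y)) (sym (+-∸-assoc 1 y<k)) (w-step (∸-monoʳ-< z<s y<k)))
    where
    y<k : y < k
    y<k = +-cancelˡ-< (suc k) y k (≤-pred (subst (suc (suc k + y) <_) (twice-suc k) x+1<2k+2))

  vertex-increasing : ∀ {x y} → x < y → y < 2 * suc k → vertex x < vertex y
  vertex-increasing = increasing-of-step vertex vertex-step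

  vertex-bounded : ∀ {x} → x < 2 * suc k → vertex x < N
  vertex-bounded {x} x<2k+2 with m≤n⇒m<n∨m≡n (≤-pred (subst (x <_) (twice-suc k) x<2k+2))
  ... | inj₁ x<2k+1 = <-trans (subst (vertex x <_) vertex-last (vertex-increasing x<2k+1 2k+1<2k+2)) bounded
    where
    2k+1<2k+2 : suc k + k < 2 * suc k
    2k+1<2k+2 = subst (suc k + k <_) (sym (twice-suc k)) ≤-refl
  ... | inj₂ refl   = subst (_< N) (sym vertex-last) bounded

  vertex-edge : ∀ {a b} → PathEdge k a b → T (E (vertex a) (vertex b))
  vertex-edge (rung-edge {j} j≤k) =
    subst₂ (λ p q → T (E p q)) (sym (vertex-left (m∸n≤m k j))) (sym (vertex-right j)) (rung (m∸n≤m k j))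
  vertex-edge (diagonal-edge {j} j<k) =
    subst₂ (λ p q → T (E p q)) (sym (vertex-left (m∸n≤m k (suc j))))
           (sym (trans (vertex-right j) (cong w (+-∸-assoc 1 j<k))))
           (diagonal (∸-monoʳ-< z<s j<k))

zigzag-contains : ∀ {N k} {G : OGraph N} {R} → Represents G R → Zigzag R N k → Contains G (P>< (suc k))
zigzag-contains {k = k} {R = R} rep z =
  contains-of-increasing {R = R} {S = pathAdj (suc k)} rep (λ _ _ → refl) vertex vertex-bounded vertex-increasing
    (λ x<y _ e → vertex-edge (pathAdj-edge k x<y e))
  where open ZigzagEmbedding z

-- The extremal graph

-- 2 * suc k, by a recursion under which removing the two end vertices is definitional.
pathOrder : ℕ → ℕ
pathOrder zero    = 2
pathOrder (suc k) = suc (suc (pathOrder k))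

pathOrder≡ : ∀ k → pathOrder k ≡ 2 * suc k
pathOrder≡ zero    = refl
pathOrder≡ (suc k) = trans (cong (suc ∘ suc) (trans (pathOrder≡ k) (twice (suc k)))) (sym (twice-suc (suc k)))

pathOrder-≥ : ∀ k → suc (suc k) ≤ pathOrder k
pathOrder-≥ k = subst (suc (suc k) ≤_) (sym (trans (pathOrder≡ k) (twice-suc k))) (s≤s (s≤s (m≤m+n k k)))

-- On pathOrder k + M vertices: all pairs meeting the first k or the last k vertices.
extremal : ℕ → ℕ → Adj
extremal k M a b = (a <ᵇ k) ∨ (suc (k + M) <ᵇ b)

ExtremalGraph : ∀ k M → OGraph (pathOrder k + M)
ExtremalGraph k M = record { adj = λ i j → extremal k M (toℕ i) (toℕ j) }

count-extremal : ∀ k M → count (extremal k M) (pathOrder k + M) ≡ bound k (pathOrder k + M)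
count-extremal zero    M = count-edgeless (extremal 0 M) (2 + M) λ {a} {b} _ b<N e →
  subst T (<ᵇ-false (≤-pred b<N)) e
count-extremal (suc k) M = begin
  count (extremal (suc k) M) (suc (suc n))
    ≡⟨ count-suc-first (extremal (suc k) M) (suc n) ⟩
  ∑[ b < suc n ] 1 + count (extremal k M) (suc n)
    ≡⟨ cong₂ _+_ (∑-ones (suc n) (λ _ → refl)) (count-suc-last (extremal k M) n) ⟩
  suc n + (count (extremal k M) n + ∑[ a < n ] indicator (extremal k M a n))
    ≡⟨ cong (λ x → suc n + (x + ∑[ a < n ] indicator (extremal k M a n))) (count-extremal k M) ⟩
  suc n + (bound k n + ∑[ a < n ] indicator (extremal k M a n))
    ≡⟨ cong (λ x → suc n + (bound k n + x)) (∑-ones n λ {a} _ → cong indicator (lastColumnFull a)) ⟩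
  suc n + (bound k n + n)
    ≡⟨ +-comm (suc n) (bound k n + n) ⟩
  (bound k n + n) + suc n
    ≡⟨ +-assoc (bound k n) n (suc n) ⟩
  bound k n + (n + suc n)
    ≡⟨ cong (bound k n +_) (+-comm n (suc n)) ⟩
  bound (suc k) (suc (suc n)) ∎
  where
  open ≡-Reasoning
  n : ℕ
  n = pathOrder k + M
  lastColumnFull : ∀ a → extremal k M a n ≡ true
  lastColumnFull a =
    trans (cong ((a <ᵇ k) ∨_) (dec-true (suc (k + M) <? n) (+-monoˡ-≤ M (pathOrder-≥ k)))) (∨-zeroʳ (a <ᵇ k))

module PathMiddle (k : ℕ) where

  k+1<2k+2 : suc k < 2 * suc k
  k+1<2k+2 = subst (suc k <_) (sym (twice-suc k)) (s≤s (s≤s (m≤m+n k k)))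

  k<2k+2 : k < 2 * suc k
  k<2k+2 = <-trans (n<1+n k) k+1<2k+2

  lower upper : Fin (2 * suc k)
  lower = fromℕ< k<2k+2
  upper = fromℕ< k+1<2k+2

  toℕ-lower : toℕ lower ≡ k
  toℕ-lower = toℕ-fromℕ< k<2k+2

  toℕ-upper : toℕ upper ≡ suc k
  toℕ-upper = toℕ-fromℕ< k+1<2k+2

  lower<upper : toℕ lower < toℕ upper
  lower<upper = subst₂ _<_ (sym toℕ-lower) (sym toℕ-upper) ≤-refl

  above-upper : 2 * suc k ∸ toℕ upper ≡ suc k
  above-upper = trans (cong₂ _∸_ (twice (suc k)) toℕ-upper) (m+n∸m≡n (suc k) (suc k))

  middle-edge : Edge (P>< (suc k)) lower upper
  middle-edge = inj₁ (lower<upper , Equivalence.to T-≡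
    (subst₂ (λ a b → T (pathAdj (suc k) a b)) (sym toℕ-lower) (sym toℕ-upper) (pathAdj-middle k)))

extremal-middle : ∀ k M {a b} → k ≤ a → b ≤ suc (k + M) → ¬ T (extremal k M a b)
extremal-middle k M {a} {b} k≤a b≤t e with Equivalence.to T-∨ e
... | inj₁ a<k = <⇒≱ (<ᵇ⇒< a k a<k) k≤a
... | inj₂ t<b = <⇒≱ (<ᵇ⇒< (suc (k + M)) b t<b) b≤t

module _ (k M : ℕ) where
  open PathMiddle k

  -- An increasing embedding leaves k vertices below and k above the image of the middle edge.
  middle-images : (f : Fin (2 * suc k) → Fin (pathOrder k + M)) → Increasing f →
                  k ≤ toℕ (f lower) × toℕ (f upper) ≤ suc (k + M)
  middle-images f increasing =
    subst (_≤ toℕ (f lower)) toℕ-lower (increasing-≥ f increasing lower) ,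
    +-cancelˡ-≤ (suc k) _ _ (begin
      suc k + toℕ (f upper)                   ≡⟨ +-comm (suc k) _ ⟩
      toℕ (f upper) + suc k                   ≡⟨ cong (toℕ (f upper) +_) above-upper ⟨
      toℕ (f upper) + (2 * suc k ∸ toℕ upper) ≤⟨ increasing-room f increasing upper ⟩
      pathOrder k + M                         ≡⟨ cong (_+ M) (trans (pathOrder≡ k) (twice (suc k))) ⟩
      (suc k + suc k) + M                     ≡⟨ +-assoc (suc k) (suc k) M ⟩
      suc k + suc (k + M)                     ∎)
    where open ≤-Reasoning

  extremal-avoids : Avoids (ExtremalGraph k M) (P>< (suc k))
  extremal-avoids (f , increasing , edges) with edges lower upper middle-edge
  ... | inj₁ (_ , e) = let k≤f₀ , f₁≤t = middle-images f increasing
                       in extremal-middle k M k≤f₀ f₁≤t (Equivalence.from T-≡ e)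
  ... | inj₂ (upper<lower , _) = <-asym upper<lower (increasing lower upper lower<upper)

ordered-turán-number : ∀ k M →
  IsOrderedTuranNumber (pathOrder k + M) (P>< (suc k)) (bound k (pathOrder k + M))
ordered-turán-number k M = extremal-graph , upper-bound
  where
  N : ℕ
  N = pathOrder k + M
  extremal-graph : Σ (OGraph N) λ G → Avoids G (P>< (suc k)) × edgeCount G ≡ bound k N
  extremal-graph =
    ExtremalGraph k M , extremal-avoids k M ,
    trans (edgeCount-represents {G = ExtremalGraph k M} {R = extremal k M} (λ _ _ → refl)) (count-extremal k M)
  upper-bound : ∀ G → Avoids G (P>< (suc k)) → edgeCount G ≤ bound k N
  upper-bound G avoids =
    subst (_≤ bound k N) (sym (edgeCount-represents (adjℕ-represents G)))
          (count-≤-bound k N (adjℕ G) (avoids ∘ zigzag-contains (adjℕ-represents G)))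

C2-suc : ∀ n → suc n C 2 ≡ n + n C 2
C2-suc n = trans (sym (nCk+nC[k+1]≡[n+1]C[k+1] n 1)) (cong (_+ n C 2) (nC1≡n n))

bound-step : ∀ p M → 2 ≤ p →
             (((p ∸ 1) C 2) + (p ∸ 2) * (M + 1)) + (suc (p + M) + (p + M)) ≡ (suc p C 2) + p * (M + 1)
bound-step (suc (suc q)) M _ = begin
  ((suc q C 2) + q * (M + 1)) + (suc (suc (suc q) + M) + (suc (suc q) + M))
    ≡⟨ solve 3 (λ c q m → (c :+ q :* (m :+ con 1)) :+ ((con 3 :+ q :+ m) :+ (con 2 :+ q :+ m))
                       := ((con 2 :+ q) :+ ((con 1 :+ q) :+ c)) :+ (con 2 :+ q) :* (m :+ con 1))
             refl (suc q C 2) q M ⟩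
  (suc (suc q) + (suc q + suc q C 2)) + suc (suc q) * (M + 1)
    ≡⟨ cong (λ x → (suc (suc q) + x) + suc (suc q) * (M + 1)) (C2-suc (suc q)) ⟨
  (suc (suc q) + suc (suc q) C 2) + suc (suc q) * (M + 1)
    ≡⟨ cong (_+ suc (suc q) * (M + 1)) (C2-suc (suc (suc q))) ⟨
  (suc (suc (suc q)) C 2) + suc (suc q) * (M + 1) ∎
  where
  open ≡-Reasoning
  open +-*-Solver
bound-step (suc zero) M (s≤s ())

bound-closed-form : ∀ k M →
  bound k (pathOrder k + M) ≡ ((pathOrder k ∸ 1) C 2) + (pathOrder k ∸ 2) * (M + 1)
bound-closed-form zero    M = refl
bound-closed-form (suc k) M =
  trans (cong (_+ (suc (pathOrder k + M) + (pathOrder k + M))) (bound-closed-form k M))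
        (bound-step (pathOrder k) M (≤-trans (s≤s (s≤s z≤n)) (pathOrder-≥ k)))

corollary1p4 : (k N : ℕ) → 2 * suc k ≤ N →
    IsOrderedTuranNumber N (P>< (suc k))
      (((2 * suc k ∸ 1) C 2) + (2 * suc k ∸ 2) * (N ∸ 2 * suc k + 1))
corollary1p4 k N 2k+2≤N =
  subst₂ (λ N′ m → IsOrderedTuranNumber N′ (P>< (suc k)) m) order-eq value-eq (ordered-turán-number k M)
  where
  M : ℕ
  M = N ∸ 2 * suc k
  order-eq : pathOrder k + M ≡ N
  order-eq = trans (cong (_+ M) (pathOrder≡ k)) (m+[n∸m]≡n 2k+2≤N)
  value-eq : bound k (pathOrder k + M) ≡ ((2 * suc k ∸ 1) C 2) + (2 * suc k ∸ 2) * (M + 1)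
  value-eq = trans (bound-closed-form k M) (cong (λ p → ((p ∸ 1) C 2) + (p ∸ 2) * (M + 1)) (pathOrder≡ k))
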